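{- Every finite permutation $\pi=(A,\leqslant_1,\leqslant_2)$ is quasi-projective.
   Context: A permutation is a structure $\pi=(A,\leqslant_1,\leqslant_2)$ where $\leqslant_1$ and $\leqslant_2$ are two reflexive total orders on the set $A$. A homomorphism between permutations $(A,\leqslant_1,\leqslant_2)\to(B,\leqslant_1',\leqslant_2')$ is a map $h:A\to B$ such that $a\leqslant_1 b$ implies $h(a)\leqslant_1' h(b)$ and $a\leqslant_2 b$ implies $h(a)\leqslant_2' h(b)$; an epimorphism is a surjective homomorphism. A permutation $\pi$ is quasi-projective if for every permutation $\sigma$, every homomorphism $f:\pi\to\sigma$ and every epimorphism $j:\pi\to\sigma$, there is an endomorphism $\phi$ of $\pi$ with $j\circ\phi=f$. -}

module Defs where

open import Level using (0ℓ)
open import Data.Nat using (ℕ)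
open import Data.Fin using (Fin)
open import Data.Product using (Σ; ∃; _,_; proj₁; _×_)
open import Function.Bundles using (_↔_)
open import Relation.Binary.Core using (Rel)
open import Relation.Binary.Structures using (IsTotalOrder)
open import Relation.Binary.PropositionalEquality using (_≡_)

record Permutation : Set₁ where
  field
    Carrier : Set
    _≤₁_ : Rel Carrier 0ℓ
    _≤₂_ : Rel Carrier 0ℓ
    isTotalOrder₁ : IsTotalOrder _≡_ _≤₁_
    isTotalOrder₂ : IsTotalOrder _≡_ _≤₂_

open Permutation public

IsHomomorphism : (π σ : Permutation) → (Carrier π → Carrier σ) → Set
IsHomomorphism π σ h =
  (∀ {a b} → _≤₁_ π a b → _≤₁_ σ (h a) (h b)) ×
  (∀ {a b} → _≤₂_ π a b → _≤₂_ σ (h a) (h b))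

Hom : Permutation → Permutation → Set
Hom π σ = Σ (Carrier π → Carrier σ) (IsHomomorphism π σ)

IsSurjective : {A B : Set} → (A → B) → Set
IsSurjective {A} {B} h = ∀ (b : B) → ∃ λ (a : A) → h a ≡ b

Epi : Permutation → Permutation → Set
Epi π σ = Σ (Hom π σ) (λ j → IsSurjective (proj₁ j))

IsFinite : Permutation → Set
IsFinite π = Σ ℕ (λ n → Carrier π ↔ Fin n)

IsQuasiProjective : Permutation → Set₁
IsQuasiProjective π =
  ∀ (σ : Permutation) (f : Hom π σ) (j : Epi π σ) →
    Σ (Hom π π) (λ φ → ∀ (a : Carrier π) →
      proj₁ (proj₁ j) (proj₁ φ a) ≡ proj₁ f a)

-- Surjectivity is witnessed constructively, so an epimorphism j : π → σ has a
-- section s with j ∘ s = id. A section of a monotone surjection between total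
-- orders is itself monotone: if s x and s y were out of order, applying j would
-- put x and y out of order too, so x = y by antisymmetry. Hence s is a
-- homomorphism, and φ = s ∘ f satisfies j ∘ φ = f.
module Submission where

open import Defs
open import Level using (0ℓ)
open import Data.Product using (_,_; proj₁; proj₂)
open import Data.Sum using (inj₁; inj₂)
open import Function using (_∘_)
open import Relation.Binary.Core using (Rel)
open import Relation.Binary.Definitions using (Reflexive; Total; Antisymmetric)
open import Relation.Binary.Structures using (IsTotalOrder)
open import Relation.Binary.PropositionalEquality using (_≡_; refl; subst₂)

section : {A B : Set} (h : A → B) → IsSurjective h → B → A
section h h-surj b = proj₁ (h-surj b)

section-inverseʳ : {A B : Set} (h : A → B) (h-surj : IsSurjective h) →
                   ∀ b → h (section h h-surj b) ≡ b
section-inverseʳ h h-surj b = proj₂ (h-surj b)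

module _ {A B : Set} {_≤_ : Rel A 0ℓ} {_≤′_ : Rel B 0ℓ}
         (≤-refl : Reflexive _≤_) (≤-total : Total _≤_)
         (≤′-antisym : Antisymmetric _≡_ _≤′_)
         (h : A → B) (h-mono : ∀ {a b} → a ≤ b → h a ≤′ h b)
         (s : B → A) (s-inverseʳ : ∀ b → h (s b) ≡ b) where

  section-mono : ∀ {x y} → x ≤′ y → s x ≤ s y
  section-mono {x} {y} x≤′y with ≤-total (s x) (s y)
  ... | inj₁ sx≤sy = sx≤sy
  ... | inj₂ sy≤sx with ≤′-antisym x≤′y y≤′x
    where
      y≤′x : y ≤′ x
      y≤′x = subst₂ _≤′_ (s-inverseʳ y) (s-inverseʳ x) (h-mono sy≤sx)
  ... | refl = ≤-refl

section-isHomomorphism : (π σ : Permutation) ((j , j-surj) : Epi π σ) →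
                         IsHomomorphism σ π (section (proj₁ j) j-surj)
section-isHomomorphism π σ ((j , j-mono₁ , j-mono₂) , j-surj) =
  section-mono refl₁ total₁ antisym₁ j j-mono₁ (section j j-surj) (section-inverseʳ j j-surj) ,
  section-mono refl₂ total₂ antisym₂ j j-mono₂ (section j j-surj) (section-inverseʳ j j-surj)
  where
    open IsTotalOrder (isTotalOrder₁ π) using () renaming (refl to refl₁; total to total₁)
    open IsTotalOrder (isTotalOrder₂ π) using () renaming (refl to refl₂; total to total₂)
    open IsTotalOrder (isTotalOrder₁ σ) using () renaming (antisym to antisym₁)
    open IsTotalOrder (isTotalOrder₂ σ) using () renaming (antisym to antisym₂)

∘-isHomomorphism : (π σ τ : Permutation) {g : Carrier σ → Carrier τ} {f : Carrier π → Carrier σ} →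
                   IsHomomorphism σ τ g → IsHomomorphism π σ f → IsHomomorphism π τ (g ∘ f)
∘-isHomomorphism _ _ _ (g-mono₁ , g-mono₂) (f-mono₁ , f-mono₂) =
  (λ p → g-mono₁ (f-mono₁ p)) , (λ p → g-mono₂ (f-mono₂ p))

theorem3p1 : (π : Permutation) → IsFinite π → IsQuasiProjective π
theorem3p1 π _ σ (f , f-hom) j@((j₀ , _) , j-surj) =
  (section j₀ j-surj ∘ f , ∘-isHomomorphism π σ π (section-isHomomorphism π σ j) f-hom) ,
  (λ a → section-inverseʳ j₀ j-surj (f a))
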